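{- Let $G$ be a sparse graph that does not admit a star cutset. Then $G$ contains no diamond as an induced subgraph.
   Context: A diamond is the graph obtained from $K_4$ by removing one edge. A hole is an induced cycle of length at least four. $G$ is sparse if for every hole $H$ and vertex $v\notin V(H)$ there is an edge $ab$ of $H$ with $N(v)\cap V(H)\subseteq\{a,b\}$. A separation is a partition $(A,C,B)$ of $V(G)$ (parts possibly empty) with no edges between $A$ and $B$; it is a star separation if some $v\in C$ has $C\subseteq N[v]$, and proper if $A,B\neq\emptyset$; $G$ admits a star cutset if it has a proper star separation. -}

module Defs where

open import Data.Nat using (ℕ; suc; _+_)
open import Data.Nat.DivMod using (_%_; m%n<n)
open import Data.Fin using (Fin; toℕ; fromℕ<)
open import Data.Bool using (Bool; true; false)
open import Data.Product using (Σ; ∃; ∃-syntax; _×_; _,_)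
open import Data.Sum using (_⊎_)
open import Relation.Binary.PropositionalEquality using (_≡_; _≢_)
open import Relation.Nullary using (¬_)
open import Function.Definitions using (Injective)

record Graph : Set where
  field
    n     : ℕ
    adj   : Fin n → Fin n → Bool
    sym   : ∀ u v → adj u v ≡ adj v u
    irrefl : ∀ v → adj v v ≡ false

open Graph public

Vertex : Graph → Set
Vertex G = Fin (n G)

Adj : (G : Graph) → Vertex G → Vertex G → Set
Adj G u v = adj G u v ≡ true

InClosedNbhd : (G : Graph) → Vertex G → Vertex G → Set
InClosedNbhd G v u = u ≡ v ⊎ Adj G v u

next : {k : ℕ} → Fin (suc k) → Fin (suc k)
next {k} i = fromℕ< (m%n<n (suc (toℕ i)) (suc k))

CycAdj : {k : ℕ} → Fin (suc k) → Fin (suc k) → Set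
CycAdj i j = next i ≡ j ⊎ next j ≡ i

-- A hole: an induced cycle of length 4 + m ≥ 4, given by an injective
-- cyclic sequence of vertices v₀ … v_{3+m} such that v_i v_j is an edge
-- of G iff i and j are cyclically consecutive.
record Hole (G : Graph) : Set where
  field
    m       : ℕ
    cyc     : Fin (4 + m) → Vertex G
    inj     : Injective _≡_ _≡_ cyc
    induced : ∀ i j → (Adj G (cyc i) (cyc j) → CycAdj i j)
                    × (CycAdj i j → Adj G (cyc i) (cyc j))

open Hole public

InHole : {G : Graph} → Hole G → Vertex G → Set
InHole H u = ∃[ j ] cyc H j ≡ u

Sparse : Graph → Set
Sparse G = (H : Hole G) (v : Vertex G) → ¬ InHole H v →
  ∃[ i ] (∀ u → Adj G v u → InHole H u → u ≡ cyc H i ⊎ u ≡ cyc H (next i))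

data Part : Set where
  A C B : Part

Separation : Graph → Set
Separation G = Σ (Vertex G → Part) λ p →
  ∀ a b → p a ≡ A → p b ≡ B → ¬ Adj G a b

IsStar : (G : Graph) → Separation G → Set
IsStar G (p , _) = ∃[ v ] (p v ≡ C × (∀ u → p u ≡ C → InClosedNbhd G v u))

IsProper : (G : Graph) → Separation G → Set
IsProper G (p , _) = (∃[ a ] p a ≡ A) × (∃[ b ] p b ≡ B)

AdmitsStarCutset : Graph → Set
AdmitsStarCutset G = ∃[ S ] (IsStar G S × IsProper G S)

ContainsDiamond : Graph → Set
ContainsDiamond G = ∃[ a ] ∃[ b ] ∃[ c ] ∃[ d ]
  ( c ≢ d
  × Adj G a b × Adj G a c × Adj G a d × Adj G b c × Adj G b d
  × ¬ Adj G c d )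

-- Let a, b, c, d induce a diamond with c, d non-adjacent. Deleting N[a] ∖ {c, d}
-- from G leaves c and d in one component: otherwise the component of c, the
-- deleted star around a and the rest would form a proper star separation.
-- A shortest c–d path in what remains is induced, has length at least 2, and its
-- interior avoids N[a]; closed up through a it is a hole. The vertex b lies off
-- this hole and sees its three vertices a, c and d, so G is not sparse.
module Submission where

open import Defs
open import Data.Nat using (ℕ; zero; suc; _+_; _∸_; _≤_; _<_; z≤n; s≤s; _≤?_; _≤′_; ≤′-refl; ≤′-step)
open import Data.Nat.Properties
  using (≤-refl; ≤-trans; ≤-pred; m≤n⇒m≤1+n; <⇒≤; <⇒≢; <⇒≱; ≰⇒>; 1+n≰n; m∸n≤m; m≤n⇒m<n∨m≡n; <-cmp; ≤⇒≤′)
open import Data.Nat.DivMod using (_%_; m<n⇒m%n≡m; n%n≡0)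
open import Data.Fin using (Fin; toℕ; fromℕ<; _≟_) renaming (zero to fzero)
open import Data.Fin.Properties using (toℕ-injective; toℕ≤pred[n]; toℕ-fromℕ<; pigeonhole; any?)
open import Data.Bool using (true) renaming (_≟_ to _≟ᵇ_)
open import Data.Product using (Σ; ∃-syntax; _×_; _,_; proj₁; proj₂)
open import Data.Sum using (_⊎_; inj₁; inj₂; [_,_])
open import Data.Empty using (⊥; ⊥-elim)
open import Function using (_∘_; const)
open import Relation.Binary using (tri<; tri≈; tri>)
open import Relation.Binary.PropositionalEquality
  using (_≡_; _≢_; refl; trans; cong; subst; subst₂; ≢-sym) renaming (sym to ≡-sym)
open import Relation.Nullary using (¬_; Dec; yes; no; contradiction)
open import Relation.Nullary.Decidable using (_⊎-dec_; _×-dec_; ¬?)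
open import Relation.Unary using (Decidable)

module _ (G : Graph) where

  Adj? : (u v : Vertex G) → Dec (Adj G u v)
  Adj? u v = adj G u v ≟ᵇ true

  Adj-sym : {u v : Vertex G} → Adj G u v → Adj G v u
  Adj-sym {u} {v} = trans (Graph.sym G v u)

  Adj-irrefl : {u v : Vertex G} → u ≡ v → ¬ Adj G u v
  Adj-irrefl {u} refl u~u with trans (≡-sym u~u) (irrefl G u)
  ... | ()

  InjectiveUpTo : ℕ → (ℕ → Vertex G) → Set
  InjectiveUpTo k f = ∀ {i j} → i ≤ k → j ≤ k → f i ≡ f j → i ≡ j

  ChordlessUpTo : ℕ → (ℕ → Vertex G) → Set
  ChordlessUpTo k f = ∀ {i j} → i ≤ k → j ≤ k → Adj G (f i) (f j) → j ≡ suc i ⊎ i ≡ suc j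

_◂_ : {A : Set} → A → (ℕ → A) → ℕ → A
(x ◂ f) zero    = x
(x ◂ f) (suc t) = f t

module Component (G : Graph) {P : Vertex G → Set} (P? : Decidable P) (s : Vertex G) where

  record Walk (y : Vertex G) (k : ℕ) (f : ℕ → Vertex G) : Set where
    field
      start  : f 0 ≡ y
      end    : f k ≡ s
      step   : ∀ i → i < k → Adj G (f i) (f (suc i))
      inside : ∀ i → i ≤ k → P (f i)

  open Walk public

  Walk-◂ : ∀ {u v k f} → Adj G u v → P u → Walk v k f → Walk u (suc k) (u ◂ f)
  Walk-◂ {u} u~v Pu w = record
    { start  = refl
    ; end    = end w
    ; step   = λ { zero _ → subst (Adj G u) (≡-sym (start w)) u~v ; (suc i) (s≤s i<k) → step w i i<k }
    ; inside = λ { zero _ → Pu ; (suc i) (s≤s i≤k) → inside w i i≤k }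
    }

  Walk-tail : ∀ {y k f} → Walk y (suc k) f → Walk (f 1) k (f ∘ suc)
  Walk-tail w = record
    { start  = refl
    ; end    = end w
    ; step   = λ i i<k → step w (suc i) (s≤s i<k)
    ; inside = λ i i≤k → inside w (suc i) (s≤s i≤k)
    }

  Walk-drop : ∀ {y k f} e → e ≤ k → Walk y k f → Walk (f e) (k ∸ e) (λ t → f (e + t))
  Walk-drop zero    _         w = record { start = refl ; end = end w ; step = step w ; inside = inside w }
  Walk-drop (suc e) (s≤s e≤k) w = Walk-drop e e≤k (Walk-tail w)

  Walk-prefix : ∀ {y k f i} → i ≤ k → f i ≡ s → Walk y k f → Walk y i f
  Walk-prefix i≤k fi≡s w = record
    { start  = start w
    ; end    = fi≡s
    ; step   = λ t t<i → step w t (≤-trans t<i i≤k)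
    ; inside = λ t t≤i → inside w t (≤-trans t≤i i≤k)
    }

  Shorter : Vertex G → ℕ → Set
  Shorter y k = ∃[ k′ ] ∃[ g ] (k′ < k × Walk y k′ g)

  -- Bypass f (suc i), …, f (j ∸ 1); the recursion on i peels off the first vertex.
  chord⇒shorter : ∀ {y k f i j} → suc i < j → j ≤ k → Adj G (f i) (f j) → Walk y k f → Shorter y k
  chord⇒shorter {y} {k} {f} {zero} {j} 1<j j≤k f0~fj w =
    suc (k ∸ j) , y ◂ (λ t → f (j + t)) , length< 1<j j≤k ,
    Walk-◂ (subst (λ v → Adj G v (f j)) (start w) f0~fj)
           (subst P (start w) (inside w 0 z≤n))
           (Walk-drop j j≤k w)
    where
    length< : ∀ {j k} → 1 < j → j ≤ k → suc (k ∸ j) < k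
    length< {suc (suc j)} {suc (suc k)} _ (s≤s (s≤s _)) = s≤s (s≤s (m∸n≤m k j))
    length< {suc zero} (s≤s ()) _
  chord⇒shorter {y} {suc k} {f} {suc i} {suc j} (s≤s i+1<j) (s≤s j≤k) chord w
    with chord⇒shorter i+1<j j≤k chord (Walk-tail w)
  ... | k′ , g , k′<k , w′ =
    suc k′ , y ◂ g , s≤s k′<k ,
    Walk-◂ (subst (λ v → Adj G v (f 1)) (start w) (step w 0 (s≤s z≤n)))
           (subst P (start w) (inside w 0 z≤n))
           w′

  record Path (y : Vertex G) (k : ℕ) (f : ℕ → Vertex G) : Set where
    field
      walk      : Walk y k f
      injective : InjectiveUpTo G k f
      chordless : ChordlessUpTo G k f

  open Path public

  shortest⇒path : ∀ {y k f} → Walk y k f → (∀ {k′ g} → Walk y k′ g → k ≤ k′) → Path y k f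
  shortest⇒path {y} {k} {f} w shortest = record { walk = w ; injective = injective′ ; chordless = chordless′ }
    where
    not-shorter : ¬ Shorter y k
    not-shorter (_ , _ , k′<k , w′) = <⇒≱ k′<k (shortest w′)

    no-repeat : ∀ {i j} → i < j → j ≤ k → f i ≢ f j
    no-repeat {i} {j} i<j j≤k fi≡fj with m≤n⇒m<n∨m≡n j≤k
    ... | inj₁ j<k = not-shorter (chord⇒shorter (s≤s i<j) j<k fi~fj+1 w)
      where
      fi~fj+1 : Adj G (f i) (f (suc j))
      fi~fj+1 = subst (λ v → Adj G v (f (suc j))) (≡-sym fi≡fj) (step w j j<k)
    ... | inj₂ refl = not-shorter (i , f , i<j , Walk-prefix (<⇒≤ i<j) (trans fi≡fj (end w)) w)

    adjacent⇒consecutive : ∀ {i j} → i < j → j ≤ k → Adj G (f i) (f j) → j ≡ suc i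
    adjacent⇒consecutive i<j j≤k fi~fj with m≤n⇒m<n∨m≡n i<j
    ... | inj₁ i+1<j = ⊥-elim (not-shorter (chord⇒shorter i+1<j j≤k fi~fj w))
    ... | inj₂ i+1≡j = ≡-sym i+1≡j

    injective′ : InjectiveUpTo G k f
    injective′ {i} {j} i≤k j≤k fi≡fj with <-cmp i j
    ... | tri< i<j _ _ = contradiction fi≡fj (no-repeat i<j j≤k)
    ... | tri≈ _ i≡j _ = i≡j
    ... | tri> _ _ j<i = contradiction (≡-sym fi≡fj) (no-repeat j<i i≤k)

    chordless′ : ChordlessUpTo G k f
    chordless′ {i} {j} i≤k j≤k fi~fj with <-cmp i j
    ... | tri< i<j _ _ = inj₁ (adjacent⇒consecutive i<j j≤k fi~fj)
    ... | tri≈ _ i≡j _ = ⊥-elim (Adj-irrefl G (cong f i≡j) fi~fj)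
    ... | tri> _ _ j<i = inj₂ (adjacent⇒consecutive j<i i≤k (Adj-sym G fi~fj))

  Path⇒length< : ∀ {y k f} → Path y k f → k < n G
  Path⇒length< {k = k} {f} p with n G ≤? k
  ... | no n≰k = ≰⇒> n≰k
  ... | yes n≤k with pigeonhole (s≤s n≤k) (f ∘ toℕ)
  ...   | i , j , i<j , fi≡fj =
    contradiction (injective p (toℕ≤pred[n] i) (toℕ≤pred[n] j) fi≡fj) (<⇒≢ i<j)

  Reach : ℕ → Vertex G → Set
  Reach zero    u = u ≡ s × P u
  Reach (suc L) u = Reach L u ⊎ ∃[ v ] (Adj G u v × P u × Reach L v)

  Reach? : ∀ L → Decidable (Reach L)
  Reach? zero    u = (u ≟ s) ×-dec P? u
  Reach? (suc L) u = Reach? L u ⊎-dec any? (λ v → Adj? G u v ×-dec P? u ×-dec Reach? L v)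

  Reach-mono : ∀ {L L′ u} → L ≤ L′ → Reach L u → Reach L′ u
  Reach-mono = go ∘ ≤⇒≤′
    where
    go : ∀ {L L′ u} → L ≤′ L′ → Reach L u → Reach L′ u
    go ≤′-refl       r = r
    go (≤′-step L≤L′) r = inj₁ (go L≤L′ r)

  reach⇒walk : ∀ {L y} → Reach L y → ∃[ k ] ∃[ f ] (k ≤ L × Walk y k f)
  reach⇒walk {zero} {y} (refl , Py) =
    0 , const y , z≤n , record { start = refl ; end = refl ; step = λ _ () ; inside = λ _ _ → Py }
  reach⇒walk {suc L} (inj₁ r) with reach⇒walk r
  ... | k , f , k≤L , w = k , f , m≤n⇒m≤1+n k≤L , w
  reach⇒walk {suc L} {y} (inj₂ (v , y~v , Py , r)) with reach⇒walk r
  ... | k , f , k≤L , w = suc k , y ◂ f , s≤s k≤L , Walk-◂ y~v Py w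

  walk⇒reach : ∀ {y k f} → Walk y k f → Reach k y
  walk⇒reach {k = zero} w = trans (≡-sym (start w)) (end w) , subst P (start w) (inside w 0 z≤n)
  walk⇒reach {y} {suc k} {f} w =
    inj₂ (f 1 , subst (λ v → Adj G v (f 1)) (start w) (step w 0 (s≤s z≤n)) ,
          subst P (start w) (inside w 0 z≤n) , walk⇒reach (Walk-tail w))

  least-reach : ∀ {L y} → Reach L y → ∃[ L′ ] (Reach L′ y × (∀ {L″} → Reach L″ y → L′ ≤ L″))
  least-reach {zero}      r = 0 , r , λ _ → z≤n
  least-reach {suc L} {y} r with Reach? L y
  ... | yes r′ = least-reach r′
  ... | no ¬r  = suc L , r , λ r″ → ≰⇒> (λ L″≤L → ¬r (Reach-mono L″≤L r″))

  reach⇒path : ∀ {L y} → Reach L y → ∃[ k ] ∃[ f ] Path y k f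
  reach⇒path r with least-reach r
  ... | L , rL , least with reach⇒walk rL
  ...   | k , f , k≤L , w = k , f , shortest⇒path w (λ w′ → ≤-trans k≤L (least (walk⇒reach w′)))

  Reachable : Vertex G → Set
  Reachable = Reach (n G)

  -- A shortest walk is a path, hence shorter than n G; so n G steps always suffice.
  Reachable-closed : ∀ {u v} → Adj G u v → P u → Reachable v → Reachable u
  Reachable-closed {u} u~v Pu rv with reach⇒path {suc (n G)} {u} (inj₂ (_ , u~v , Pu , rv))
  ... | k , f , p = Reach-mono (<⇒≤ (Path⇒length< p)) (walk⇒reach (walk p))

module _ {G : Graph} {P : Vertex G → Set} (P? : Decidable P) (s : Vertex G) where
  open Component G P? s

  data Label (u : Vertex G) : Part → Set where
    outside   : ¬ P u → Label u C
    reached   : P u → Reachable u → Label u A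
    unreached : P u → ¬ Reachable u → Label u B

  label : (u : Vertex G) → Σ Part (Label u)
  label u with P? u | Reach? (n G) u
  ... | no ¬Pu | _      = C , outside ¬Pu
  ... | yes Pu | yes ru = A , reached Pu ru
  ... | yes Pu | no ¬ru = B , unreached Pu ¬ru

  Label-unique : ∀ {u x y} → Label u x → Label u y → x ≡ y
  Label-unique (outside _)      (outside _)       = refl
  Label-unique (reached _ _)    (reached _ _)     = refl
  Label-unique (unreached _ _)  (unreached _ _)   = refl
  Label-unique (outside ¬Pu)    (reached Pu _)    = contradiction Pu ¬Pu
  Label-unique (outside ¬Pu)    (unreached Pu _)  = contradiction Pu ¬Pu
  Label-unique (reached Pu _)   (outside ¬Pu)     = contradiction Pu ¬Pu
  Label-unique (unreached Pu _) (outside ¬Pu)     = contradiction Pu ¬Pu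
  Label-unique (reached _ ru)   (unreached _ ¬ru) = contradiction ru ¬ru
  Label-unique (unreached _ ¬ru) (reached _ ru)   = contradiction ru ¬ru

  part : Vertex G → Part
  part = proj₁ ∘ label

  part≡ : ∀ {u x} → Label u x → part u ≡ x
  part≡ {u} = Label-unique (proj₂ (label u))

  part≡⇒Label : ∀ {u x} → part u ≡ x → Label u x
  part≡⇒Label {u} eq = subst (Label u) eq (proj₂ (label u))

  componentSeparation : Separation G
  componentSeparation = part , λ x y px py → no-edge (part≡⇒Label px) (part≡⇒Label py)
    where
    no-edge : ∀ {x y} → Label x A → Label y B → ¬ Adj G x y
    no-edge (reached _ rx) (unreached Py ¬ry) x~y = ¬ry (Reachable-closed (Adj-sym G x~y) Py rx)

  noStarCutset⇒reachable : ¬ AdmitsStarCutset G → (a : Vertex G) → ¬ P a →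
    (∀ u → ¬ P u → InClosedNbhd G a u) → P s → ∀ {t} → P t → Reachable t
  noStarCutset⇒reachable noCutset a ¬Pa star Ps {t} Pt with Reach? (n G) t
  ... | yes rt = rt
  ... | no ¬rt = ⊥-elim (noCutset (componentSeparation , isStar , isProper))
    where
    isStar : IsStar G componentSeparation
    isStar = a , part≡ (outside ¬Pa) , λ u pu → star u (outside⇒¬P (part≡⇒Label pu))
      where
      outside⇒¬P : ∀ {u} → Label u C → ¬ P u
      outside⇒¬P (outside ¬Pu) = ¬Pu
    isProper : IsProper G componentSeparation
    isProper = (s , part≡ (reached Ps (Reach-mono z≤n (refl , Ps)))) , (t , part≡ (unreached Pt ¬rt))

CycSucc : ℕ → ℕ → ℕ → Set
CycSucc K p q = q ≡ suc p ⊎ (p ≡ K × q ≡ 0)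

CycSucc-unique : ∀ {K p q q′} → q ≤ K → q′ ≤ K → CycSucc K p q → CycSucc K p q′ → q ≡ q′
CycSucc-unique _   _    (inj₁ refl)       (inj₁ refl)       = refl
CycSucc-unique q≤K _    (inj₁ refl)       (inj₂ (refl , _)) = contradiction q≤K 1+n≰n
CycSucc-unique _   q′≤K (inj₂ (refl , _)) (inj₁ refl)       = contradiction q′≤K 1+n≰n
CycSucc-unique _   _    (inj₂ (_ , refl)) (inj₂ (_ , refl)) = refl

CycSucc-next : ∀ {K} (i : Fin (suc K)) → CycSucc K (toℕ i) (toℕ (next i))
CycSucc-next {K} i with m≤n⇒m<n∨m≡n (toℕ≤pred[n] i)
... | inj₁ i<K = inj₁ (trans (toℕ-fromℕ< _) (m<n⇒m%n≡m (s≤s i<K)))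
... | inj₂ i≡K = inj₂ (i≡K , trans (toℕ-fromℕ< _) (subst (λ x → suc x % suc K ≡ 0) (≡-sym i≡K) (n%n≡0 (suc K))))

next≡⇒CycSucc : ∀ {K} {i j : Fin (suc K)} → next i ≡ j → CycSucc K (toℕ i) (toℕ j)
next≡⇒CycSucc {i = i} refl = CycSucc-next i

CycSucc⇒next≡ : ∀ {K} {i j : Fin (suc K)} → CycSucc K (toℕ i) (toℕ j) → next i ≡ j
CycSucc⇒next≡ {i = i} {j} c = toℕ-injective (CycSucc-unique (toℕ≤pred[n] (next i)) (toℕ≤pred[n] j) (CycSucc-next i) c)

CycAdjℕ : ℕ → ℕ → ℕ → Set
CycAdjℕ K p q = CycSucc K p q ⊎ CycSucc K q p

CycAdj⇒CycAdjℕ : ∀ {K} {i j : Fin (suc K)} → CycAdj i j → CycAdjℕ K (toℕ i) (toℕ j)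
CycAdj⇒CycAdjℕ = [ inj₁ ∘ next≡⇒CycSucc , inj₂ ∘ next≡⇒CycSucc ]

CycAdjℕ⇒CycAdj : ∀ {K} {i j : Fin (suc K)} → CycAdjℕ K (toℕ i) (toℕ j) → CycAdj i j
CycAdjℕ⇒CycAdj = [ inj₁ ∘ CycSucc⇒next≡ , inj₂ ∘ CycSucc⇒next≡ ]

module PathHole {G : Graph} (a : Vertex G) {m : ℕ} {f : ℕ → Vertex G}
  (step : ∀ i → i < 2 + m → Adj G (f i) (f (suc i)))
  (injective : InjectiveUpTo G (2 + m) f)
  (chordless : ChordlessUpTo G (2 + m) f)
  (f≢a : ∀ {t} → t ≤ 2 + m → f t ≢ a)
  (a~f⇒end : ∀ {t} → t ≤ 2 + m → Adj G a (f t) → t ≡ 0 ⊎ t ≡ 2 + m)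
  (a~first : Adj G a (f 0))
  (a~last : Adj G a (f (2 + m)))
  where

  K : ℕ
  K = 3 + m

  cycle : ℕ → Vertex G
  cycle = a ◂ f

  cycle-injective : ∀ {p q} → p ≤ K → q ≤ K → cycle p ≡ cycle q → p ≡ q
  cycle-injective {zero}  {zero}  _   _   _ = refl
  cycle-injective {zero}  {suc q} _   q≤K e = contradiction (≡-sym e) (f≢a (≤-pred q≤K))
  cycle-injective {suc p} {zero}  p≤K _   e = contradiction e (f≢a (≤-pred p≤K))
  cycle-injective {suc p} {suc q} p≤K q≤K e = cong suc (injective (≤-pred p≤K) (≤-pred q≤K) e)

  cycle-chordless : ∀ {p q} → p ≤ K → q ≤ K → Adj G (cycle p) (cycle q) → CycAdjℕ K p q
  cycle-chordless {zero} {zero} _ _ a~a = ⊥-elim (Adj-irrefl G refl a~a)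
  cycle-chordless {zero} {suc q} _ q≤K a~fq with a~f⇒end (≤-pred q≤K) a~fq
  ... | inj₁ refl = inj₁ (inj₁ refl)
  ... | inj₂ refl = inj₂ (inj₂ (refl , refl))
  cycle-chordless {suc p} {zero} p≤K _ fp~a with a~f⇒end (≤-pred p≤K) (Adj-sym G fp~a)
  ... | inj₁ refl = inj₂ (inj₁ refl)
  ... | inj₂ refl = inj₁ (inj₂ (refl , refl))
  cycle-chordless {suc p} {suc q} p≤K q≤K fp~fq with chordless (≤-pred p≤K) (≤-pred q≤K) fp~fq
  ... | inj₁ q≡p+1 = inj₁ (inj₁ (cong suc q≡p+1))
  ... | inj₂ p≡q+1 = inj₂ (inj₁ (cong suc p≡q+1))

  cycle-step : ∀ {p q} → q ≤ K → CycSucc K p q → Adj G (cycle p) (cycle q)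
  cycle-step {zero}  _   (inj₁ refl)          = a~first
  cycle-step {suc p} q≤K (inj₁ refl)          = step p (≤-pred q≤K)
  cycle-step         _   (inj₂ (refl , refl)) = Adj-sym G a~last

  cycle-adjacent : ∀ {p q} → p ≤ K → q ≤ K → CycAdjℕ K p q → Adj G (cycle p) (cycle q)
  cycle-adjacent _   q≤K (inj₁ p→q) = cycle-step q≤K p→q
  cycle-adjacent p≤K _   (inj₂ q→p) = Adj-sym G (cycle-step p≤K q→p)

  hole : Hole G
  hole = record
    { m       = m
    ; cyc     = cycle ∘ toℕ
    ; inj     = λ {i} {j} e → toℕ-injective (cycle-injective (toℕ≤pred[n] i) (toℕ≤pred[n] j) e)
    ; induced = λ i j →
        (λ cij → CycAdjℕ⇒CycAdj (cycle-chordless (toℕ≤pred[n] i) (toℕ≤pred[n] j) cij)) ,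
        (λ cij → cycle-adjacent (toℕ≤pred[n] i) (toℕ≤pred[n] j) (CycAdj⇒CycAdjℕ cij))
    }

  a∈hole : InHole hole a
  a∈hole = fzero , refl

  f∈hole : ∀ {t} → t ≤ 2 + m → InHole hole (f t)
  f∈hole t≤k = fromℕ< (s≤s (s≤s t≤k)) , cong cycle (toℕ-fromℕ< (s≤s (s≤s t≤k)))

  ∉hole : ∀ {v} → v ≢ a → (∀ {t} → t ≤ 2 + m → f t ≢ v) → ¬ InHole hole v
  ∉hole {v} v≢a f≢v (j , e) = off (toℕ j) (toℕ≤pred[n] j) e
    where
    off : ∀ p → p ≤ K → cycle p ≢ v
    off zero    _   = ≢-sym v≢a
    off (suc t) t<K = f≢v (≤-pred t<K)

¬threeAmongTwo : {A : Set} {x y z p q : A} → x ≡ p ⊎ x ≡ q → y ≡ p ⊎ y ≡ q → z ≡ p ⊎ z ≡ q →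
  x ≢ y → x ≢ z → y ≢ z → ⊥
¬threeAmongTwo (inj₁ refl) (inj₁ refl) _           x≢y _   _   = x≢y refl
¬threeAmongTwo (inj₂ refl) (inj₂ refl) _           x≢y _   _   = x≢y refl
¬threeAmongTwo (inj₁ refl) (inj₂ refl) (inj₁ refl) _   x≢z _   = x≢z refl
¬threeAmongTwo (inj₁ refl) (inj₂ refl) (inj₂ refl) _   _   y≢z = y≢z refl
¬threeAmongTwo (inj₂ refl) (inj₁ refl) (inj₁ refl) _   _   y≢z = y≢z refl
¬threeAmongTwo (inj₂ refl) (inj₁ refl) (inj₂ refl) _   x≢z _   = x≢z refl

Sparse⇒¬threeNeighbours : {G : Graph} → Sparse G → (H : Hole G) → ∀ {v x y z} → ¬ InHole H v →
  InHole H x → InHole H y → InHole H z → Adj G v x → Adj G v y → Adj G v z →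
  x ≢ y → x ≢ z → y ≢ z → ⊥
Sparse⇒¬threeNeighbours sparse H {v} {x} {y} {z} v∉H x∈H y∈H z∈H v~x v~y v~z
  with sparse H v v∉H
... | _ , between = ¬threeAmongTwo (between x v~x x∈H) (between y v~y y∈H) (between z v~z z∈H)

module Diamond {G : Graph} {a b c d : Vertex G} (c≢d : c ≢ d)
  (a~b : Adj G a b) (a~c : Adj G a c) (a~d : Adj G a d) (b~c : Adj G b c) (b~d : Adj G b d)
  (c≁d : ¬ Adj G c d) where

  Remaining : Vertex G → Set
  Remaining u = u ≡ c ⊎ u ≡ d ⊎ (u ≢ a × ¬ Adj G a u)

  Remaining? : Decidable Remaining
  Remaining? u = (u ≟ c) ⊎-dec (u ≟ d) ⊎-dec (¬? (u ≟ a) ×-dec ¬? (Adj? G a u))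

  ¬Remaining : ∀ {v} → InClosedNbhd G a v → Adj G v c → Adj G v d → ¬ Remaining v
  ¬Remaining _         v~c _   (inj₁ v≡c)               = Adj-irrefl G v≡c v~c
  ¬Remaining _         _   v~d (inj₂ (inj₁ v≡d))        = Adj-irrefl G v≡d v~d
  ¬Remaining (inj₁ v≡a) _  _   (inj₂ (inj₂ (v≢a , _)))  = v≢a v≡a
  ¬Remaining (inj₂ a~v) _  _   (inj₂ (inj₂ (_ , a≁v)))  = a≁v a~v

  ¬Remaining⇒N[a] : ∀ u → ¬ Remaining u → InClosedNbhd G a u
  ¬Remaining⇒N[a] u ¬Ru with u ≟ a | Adj? G a u
  ... | yes u≡a | _       = inj₁ u≡a
  ... | no _    | yes a~u = inj₂ a~u
  ... | no u≢a  | no a≁u  = ⊥-elim (¬Ru (inj₂ (inj₂ (u≢a , a≁u))))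

  Remaining-≢ : ∀ {u v} → Remaining u → ¬ Remaining v → u ≢ v
  Remaining-≢ Ru ¬Rv u≡v = ¬Rv (subst Remaining u≡v Ru)

  open Component G Remaining? c

  ¬Ra : ¬ Remaining a
  ¬Ra = ¬Remaining (inj₁ refl) a~c a~d

  ¬Rb : ¬ Remaining b
  ¬Rb = ¬Remaining (inj₂ a~b) b~c b~d

  d-reachable : ¬ AdmitsStarCutset G → Reachable d
  d-reachable noCutset =
    noStarCutset⇒reachable Remaining? c noCutset a ¬Ra ¬Remaining⇒N[a] (inj₁ refl) (inj₂ (inj₁ refl))

  longPath⇒¬sparse : ∀ {m f} → Path d (2 + m) f → ¬ Sparse G
  longPath⇒¬sparse {m} {f} p sparse =
    Sparse⇒¬threeNeighbours sparse hole
      (∉hole (λ b≡a → Adj-irrefl G (≡-sym b≡a) a~b) (λ {t} t≤k → Remaining-≢ (inside w t t≤k) ¬Rb))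
      a∈hole (subst (InHole hole) (start w) (f∈hole z≤n)) (subst (InHole hole) (end w) (f∈hole ≤-refl))
      (Adj-sym G a~b) b~d b~c
      (λ a≡d → Adj-irrefl G a≡d a~d) (λ a≡c → Adj-irrefl G a≡c a~c) (≢-sym c≢d)
    where
    w : Walk d (2 + m) f
    w = walk p

    a~f⇒end : ∀ {t} → t ≤ 2 + m → Adj G a (f t) → t ≡ 0 ⊎ t ≡ 2 + m
    a~f⇒end {t} t≤k a~ft with inside w t t≤k
    ... | inj₁ ft≡c               = inj₂ (injective p t≤k ≤-refl (trans ft≡c (≡-sym (end w))))
    ... | inj₂ (inj₁ ft≡d)        = inj₁ (injective p t≤k z≤n (trans ft≡d (≡-sym (start w))))
    ... | inj₂ (inj₂ (_ , a≁ft)) = contradiction a~ft a≁ft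

    open PathHole {G} a (step w) (injective p) (chordless p)
      (λ {t} t≤k → Remaining-≢ (inside w t t≤k) ¬Ra) a~f⇒end
      (subst (Adj G a) (≡-sym (start w)) a~d) (subst (Adj G a) (≡-sym (end w)) a~c)

  noStarCutset⇒¬sparse : ¬ AdmitsStarCutset G → ¬ Sparse G
  noStarCutset⇒¬sparse noCutset with reach⇒path (d-reachable noCutset)
  ... | zero        , _ , p = ⊥-elim (c≢d (trans (≡-sym (end (walk p))) (start (walk p))))
  ... | suc zero    , _ , p =
    ⊥-elim (c≁d (Adj-sym G (subst₂ (Adj G) (start (walk p)) (end (walk p)) (step (walk p) 0 (s≤s z≤n)))))
  ... | suc (suc _) , _ , p = longPath⇒¬sparse p

lemma3p1 : (G : Graph) → Sparse G → ¬ AdmitsStarCutset G → ¬ ContainsDiamond G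
lemma3p1 G sparse noCutset (a , b , c , d , c≢d , a~b , a~c , a~d , b~c , b~d , c≁d) =
  Diamond.noStarCutset⇒¬sparse c≢d a~b a~c a~d b~c b~d c≁d noCutset sparse
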